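{- Let $\mathsf{CS}$ be any constant specification for $\mathsf{LPLTL}^{\mathsf P}$. For every formula $\phi$ and every finite set of formulas $\Gamma$: if $\Gamma\vdash_{\mathsf{CS}}\phi$, then $\Gamma\Vdash_{\mathsf{CS}}\phi$.
   Context: Language. Fix $h\ge 1$ agents $\mathsf{Ag}=\{1,\dots,h\}$ and countable sets of justification constants, justification variables, and atomic propositions $\mathsf{Prop}$. Terms: $t::=c\mid x\mid\ !t\mid t+t\mid t\cdot t$. Formulas: $\phi::=P\mid\bot\mid\phi\to\phi\mid\bigcirc\phi\mid\mathsf{Y}_w\phi\mid\phi\,\mathcal{U}\,\phi\mid\phi\,\mathcal{S}\,\phi\mid[t]_i\phi$ ($\bigcirc$ next, $\mathsf{Y}_w$ weak previous, $\mathcal U$ until, $\mathcal S$ since). Abbreviations: $\neg\phi:=\phi\to\bot$, $\top:=\neg\bot$, usual $\lor,\land,\leftrightarrow$; $\mathsf{Y}_s\phi:=\neg\mathsf{Y}_w\neg\phi$; $\Diamond\phi:=\top\,\mathcal U\,\phi$; $\Box\phi:=\neg\Diamond\neg\phi$; $\Diamond^{ - }\phi:=\top\,\mathcal S\,\phi$; $\boxminus\phi:=\neg\Diamond^{ - }\neg\phi$. The system $\mathsf{LPLTL}^{\mathsf P}$. Axioms: all propositional tautologies; $\bigcirc(\phi\to\psi)\to(\bigcirc\phi\to\bigcirc\psi)$; $\Box(\phi\to\psi)\to(\Box\phi\to\Box\psi)$; $\bigcirc\neg\phi\leftrightarrow\neg\bigcirc\phi$; $\Box(\phi\to\bigcirc\phi)\to(\phi\to\Box\phi)$;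 $\phi\,\mathcal U\,\psi\to\Diamond\psi$; $\phi\,\mathcal U\,\psi\leftrightarrow\psi\lor(\phi\land\bigcirc(\phi\,\mathcal U\,\psi))$; $\boxminus(\phi\to\psi)\to(\boxminus\phi\to\boxminus\psi)$; $\mathsf Y_w(\phi\to\psi)\to(\mathsf Y_w\phi\to\mathsf Y_w\psi)$; $\mathsf Y_s\phi\to\mathsf Y_w\phi$; $\phi\to\bigcirc\mathsf Y_s\phi$; $\phi\to\mathsf Y_w\bigcirc\phi$; $\Diamond^{ - }\mathsf Y_w\bot$; $\boxminus(\phi\to\mathsf Y_w\phi)\to(\phi\to\boxminus\phi)$; $\phi\,\mathcal S\,\psi\to\Diamond^{ - }\psi$; $\phi\,\mathcal S\,\psi\leftrightarrow\psi\lor(\phi\land\mathsf Y_s(\phi\,\mathcal S\,\psi))$; and for all agents $i$, terms $s,t$: $[t]_i(\phi\to\psi)\to([s]_i\phi\to[t\cdot s]_i\psi)$; $[t]_i\phi\to[t+s]_i\phi$ and $[s]_i\phi\to[t+s]_i\phi$; $[t]_i\phi\to\phi$; $[t]_i\phi\to[!t]_i[t]_i\phi$. A constant specification $\mathsf{CS}$ is a set of formulas $[c_n]_{i_n}\cdots[c_1]_{i_1}\phi$ ($n\ge1$, $c_k$ constants, $i_k$ agents, $\phi$ an axiom instance), downward closed: if $[c_n]_{i_n}[c_{n-1}]_{i_{n-1}}\cdots[c_1]_{i_1}\phi\in\mathsf{CS}$ with $n>1$ then $[c_{n-1}]_{i_{n-1}}\cdots[c_1]_{i_1}\phi\in\mathsf{CS}$.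 Rules: modus ponens; from $\vdash\phi$ infer each of $\vdash\bigcirc\phi$, $\vdash\mathsf Y_w\phi$, $\vdash\Box\phi$, $\vdash\boxminus\phi$; and $\vdash\psi$ for every $\psi\in\mathsf{CS}$. $\Gamma\vdash_{\mathsf{CS}}\phi$ iff there are $\psi_1,\dots,\psi_n\in\Gamma$ with $\vdash_{\mathsf{CS}}(\psi_1\land\dots\land\psi_n)\to\phi$. Models. An $\mathsf{LPLTL}^{\mathsf P}_{\mathsf{CS}}$-model is $\mathcal M=(r,S,\mathcal E_1,\dots,\mathcal E_h,\nu)$ with $S$ nonempty, $r:\mathbb N\to S$, $\nu:S\to\mathcal P(\mathsf{Prop})$, and each $\mathcal E_i:S\times\mathsf{Tm}\to\mathcal P(\mathsf{Fml})$ satisfying, for all $w,s,t,\phi,\psi$: $[t]_i\phi\in\mathsf{CS}$ implies $\phi\in\mathcal E_i(w,t)$; $\phi\to\psi\in\mathcal E_i(w,t)$ and $\phi\in\mathcal E_i(w,s)$ imply $\psi\in\mathcal E_i(w,t\cdot s)$; $\mathcal E_i(w,s)\cup\mathcal E_i(w,t)\subseteq\mathcal E_i(w,s+t)$; $\phi\in\mathcal E_i(w,t)$ implies $[t]_i\phi\in\mathcal E_i(w,!t)$. Truth at time $n$, written $(\mathcal M,r(n))\models\phi$: $P$ iff $P\in\nu(r(n))$; $\bot$ never; $\to$ classically; $\mathsf Y_w\phi$ iff $n=0$ or $\phi$ at $n-1$; $\bigcirc\phi$ iff $\phi$ at $n+1$; $\phi\,\mathcal S\,\psi$ iff some $m\le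 n$ has $\psi$ at $m$ and $\phi$ at all $k$ with $m<k\le n$; $\phi\,\mathcal U\,\psi$ iff some $m\ge n$ has $\psi$ at $m$ and $\phi$ at all $k$ with $n\le k<m$; $[t]_i\phi$ iff $\phi\in\mathcal E_i(r(n),t)$ and $\phi$ holds at $n$. $\Gamma\Vdash_{\mathsf{CS}}\phi$ means: for every $\mathsf{LPLTL}^{\mathsf P}_{\mathsf{CS}}$-model and every $n$, if all members of $\Gamma$ hold at $n$ then $\phi$ holds at $n$. -}

module Defs where

open import Data.Nat using (ℕ; _≤_; _<_; zero; suc; pred)
open import Data.Fin using (Fin)
open import Data.Bool using (Bool; true; false; _∨_; not)
open import Data.List using (List; []; _∷_)
open import Data.List.Relation.Unary.All using (All)
open import Data.List.Membership.Propositional using (_∈_)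
open import Data.Product using (Σ; _×_; _,_)
open import Data.Sum using (_⊎_)
open import Data.Empty using (⊥)
open import Data.Unit using (⊤)
open import Relation.Binary.PropositionalEquality using (_≡_)

-- Justification constants, variables and atomic propositions are indexed by ℕ
-- (countable sets).

data Tm : Set where
  con  : ℕ → Tm
  var  : ℕ → Tm
  !_   : Tm → Tm
  _⊕_  : Tm → Tm → Tm
  _⊗_  : Tm → Tm → Tm

-- Formulas over agents Fin h
data Fml (h : ℕ) : Set where
  atom : ℕ → Fml h
  falsum : Fml h
  _⇒_  : Fml h → Fml h → Fml h
  ◯    : Fml h → Fml h
  Yw   : Fml h → Fml h
  _𝒰_  : Fml h → Fml h → Fml h
  _𝒮_  : Fml h → Fml h → Fml h
  ⟦_⟧_∶_ : Tm → Fin h → Fml h → Fml h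

infixr 5 _⇒_

module _ {h : ℕ} where
  ¬' : Fml h → Fml h
  ¬' φ = φ ⇒ falsum

  ⊤' : Fml h
  ⊤' = ¬' falsum

  _∨'_ : Fml h → Fml h → Fml h
  φ ∨' ψ = ¬' φ ⇒ ψ

  _∧'_ : Fml h → Fml h → Fml h
  φ ∧' ψ = ¬' (φ ⇒ ¬' ψ)

  _⇔_ : Fml h → Fml h → Fml h
  φ ⇔ ψ = (φ ⇒ ψ) ∧' (ψ ⇒ φ)

  Ys : Fml h → Fml h
  Ys φ = ¬' (Yw (¬' φ))

  ◇ : Fml h → Fml h
  ◇ φ = ⊤' 𝒰 φ

  □ : Fml h → Fml h
  □ φ = ¬' (◇ (¬' φ))

  ◇⁻ : Fml h → Fml h
  ◇⁻ φ = ⊤' 𝒮 φ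

  ⊟ : Fml h → Fml h
  ⊟ φ = ¬' (◇⁻ (¬' φ))

  ⋀ : List (Fml h) → Fml h
  ⋀ [] = ⊤'
  ⋀ (ψ ∷ Δ) = ψ ∧' ⋀ Δ

  -- Propositional tautologies: classical evaluation treating every formula
  -- whose main connective is not ⊥ or → as a propositional atom.
  evalPL : (Fml h → Bool) → Fml h → Bool
  evalPL v falsum = false
  evalPL v (φ ⇒ ψ) = not (evalPL v φ) ∨ evalPL v ψ
  evalPL v (atom p) = v (atom p)
  evalPL v (◯ φ) = v (◯ φ)
  evalPL v (Yw φ) = v (Yw φ)
  evalPL v (φ 𝒰 ψ) = v (φ 𝒰 ψ)
  evalPL v (φ 𝒮 ψ) = v (φ 𝒮 ψ)
  evalPL v (⟦ t ⟧ i ∶ φ) = v (⟦ t ⟧ i ∶ φ)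

  Tautology : Fml h → Set
  Tautology φ = (v : Fml h → Bool) → evalPL v φ ≡ true

  data Axiom : Fml h → Set where
    taut   : ∀ {φ} → Tautology φ → Axiom φ
    nextK  : ∀ φ ψ → Axiom (◯ (φ ⇒ ψ) ⇒ (◯ φ ⇒ ◯ ψ))
    boxK   : ∀ φ ψ → Axiom (□ (φ ⇒ ψ) ⇒ (□ φ ⇒ □ ψ))
    nextFun : ∀ φ → Axiom (◯ (¬' φ) ⇔ ¬' (◯ φ))
    ind    : ∀ φ → Axiom (□ (φ ⇒ ◯ φ) ⇒ (φ ⇒ □ φ))
    untilD : ∀ φ ψ → Axiom ((φ 𝒰 ψ) ⇒ ◇ ψ)
    untilF : ∀ φ ψ → Axiom ((φ 𝒰 ψ) ⇔ (ψ ∨' (φ ∧' ◯ (φ 𝒰 ψ))))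
    pboxK  : ∀ φ ψ → Axiom (⊟ (φ ⇒ ψ) ⇒ (⊟ φ ⇒ ⊟ ψ))
    ywK    : ∀ φ ψ → Axiom (Yw (φ ⇒ ψ) ⇒ (Yw φ ⇒ Yw ψ))
    ysyw   : ∀ φ → Axiom (Ys φ ⇒ Yw φ)
    nextYs : ∀ φ → Axiom (φ ⇒ ◯ (Ys φ))
    ywNext : ∀ φ → Axiom (φ ⇒ Yw (◯ φ))
    start  : Axiom (◇⁻ (Yw falsum))
    pind   : ∀ φ → Axiom (⊟ (φ ⇒ Yw φ) ⇒ (φ ⇒ ⊟ φ))
    sinceD : ∀ φ ψ → Axiom ((φ 𝒮 ψ) ⇒ ◇⁻ ψ)
    sinceF : ∀ φ ψ → Axiom ((φ 𝒮 ψ) ⇔ (ψ ∨' (φ ∧' Ys (φ 𝒮 ψ))))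
    jApp   : ∀ i s t φ ψ → Axiom ((⟦ t ⟧ i ∶ (φ ⇒ ψ)) ⇒ ((⟦ s ⟧ i ∶ φ) ⇒ (⟦ t ⊗ s ⟧ i ∶ ψ)))
    jSumL  : ∀ i s t φ → Axiom ((⟦ t ⟧ i ∶ φ) ⇒ (⟦ t ⊕ s ⟧ i ∶ φ))
    jSumR  : ∀ i s t φ → Axiom ((⟦ s ⟧ i ∶ φ) ⇒ (⟦ t ⊕ s ⟧ i ∶ φ))
    jRefl  : ∀ i t φ → Axiom ((⟦ t ⟧ i ∶ φ) ⇒ φ)
    jIntro : ∀ i t φ → Axiom ((⟦ t ⟧ i ∶ φ) ⇒ (⟦ ! t ⟧ i ∶ (⟦ t ⟧ i ∶ φ)))

  data CSShape : Fml h → Set where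
    base : ∀ c i {φ} → Axiom φ → CSShape (⟦ con c ⟧ i ∶ φ)
    step : ∀ c i {ψ} → CSShape ψ → CSShape (⟦ con c ⟧ i ∶ ψ)

  record ConstSpec : Set₁ where
    field
      _∈CS    : Fml h → Set
      shape   : ∀ {ψ} → ψ ∈CS → CSShape ψ
      downward : ∀ c i ψ → (⟦ con c ⟧ i ∶ ψ) ∈CS → CSShape ψ → ψ ∈CS
  open ConstSpec public

  data ⊢[_]_ (CS : ConstSpec) : Fml h → Set where
    ax   : ∀ {φ} → Axiom φ → ⊢[ CS ] φ
    mp   : ∀ {φ ψ} → ⊢[ CS ] (φ ⇒ ψ) → ⊢[ CS ] φ → ⊢[ CS ] ψ
    necN : ∀ {φ} → ⊢[ CS ] φ → ⊢[ CS ] (◯ φ)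
    necY : ∀ {φ} → ⊢[ CS ] φ → ⊢[ CS ] (Yw φ)
    necB : ∀ {φ} → ⊢[ CS ] φ → ⊢[ CS ] (□ φ)
    necP : ∀ {φ} → ⊢[ CS ] φ → ⊢[ CS ] (⊟ φ)
    csAx : ∀ {ψ} → _∈CS CS ψ → ⊢[ CS ] ψ

  _⊢[_]_ : List (Fml h) → ConstSpec → Fml h → Set
  Γ ⊢[ CS ] φ = Σ (List (Fml h)) λ Δ → All (_∈ Γ) Δ × ⊢[ CS ] (⋀ Δ ⇒ φ)

  record Model (CS : ConstSpec) : Set₁ where
    field
      S  : Set
      r  : ℕ → S
      ν  : S → ℕ → Set                       -- ν(w) ⊆ Prop, as a predicate
      E  : Fin h → S → Tm → Fml h → Set      -- φ ∈ E_i(w,t)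
      E-cs  : ∀ i w t φ → _∈CS CS (⟦ t ⟧ i ∶ φ) → E i w t φ
      E-app : ∀ i w s t φ ψ → E i w t (φ ⇒ ψ) → E i w s φ → E i w (t ⊗ s) ψ
      E-sumL : ∀ i w s t φ → E i w s φ → E i w (s ⊕ t) φ
      E-sumR : ∀ i w s t φ → E i w t φ → E i w (s ⊕ t) φ
      E-bang : ∀ i w t φ → E i w t φ → E i w (! t) (⟦ t ⟧ i ∶ φ)
  open Model public

  _,_⊨_ : {CS : ConstSpec} → Model CS → ℕ → Fml h → Set
  M , n ⊨ atom p = ν M (r M n) p
  M , n ⊨ falsum = ⊥
  M , n ⊨ (φ ⇒ ψ) = M , n ⊨ φ → M , n ⊨ ψ
  M , n ⊨ ◯ φ = M , suc n ⊨ φ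
  M , zero ⊨ Yw φ = ⊤
  M , suc n ⊨ Yw φ = M , n ⊨ φ
  M , n ⊨ (φ 𝒰 ψ) = Σ ℕ λ m → n ≤ m × M , m ⊨ ψ × (∀ k → n ≤ k → k < m → M , k ⊨ φ)
  M , n ⊨ (φ 𝒮 ψ) = Σ ℕ λ m → m ≤ n × M , m ⊨ ψ × (∀ k → m < k → k ≤ n → M , k ⊨ φ)
  M , n ⊨ (⟦ t ⟧ i ∶ φ) = E M i (r M n) t φ × M , n ⊨ φ

  _⊩[_]_ : List (Fml h) → ConstSpec → Fml h → Set₁
  Γ ⊩[ CS ] φ = (M : Model CS) (n : ℕ) → All (λ ψ → M , n ⊨ ψ) Γ → M , n ⊨ φ

module Submission where

open import Defs
open import Data.Nat using (ℕ; zero; suc; _≤_; _<_; _≤′_; ≤′-refl; ≤′-step; z≤n; s≤s)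
open import Data.Nat.Properties
  using (≤-refl; <⇒≤; <⇒≱; ≤⇒≯; m≤n⇒m≤1+n; m≤n⇒m<n∨m≡n; ≤⇒≤′; ≤′⇒≤)
open import Data.Bool using (Bool)
open import Data.List using (List; []; _∷_)
open import Data.List.Relation.Unary.All using (All; []; _∷_; lookup)
open import Data.List.Membership.Propositional using (_∈_)
open import Data.Product using (_×_; _,_; ∃-syntax; uncurry)
open import Data.Sum using (_⊎_; inj₁; inj₂; map₂)
open import Data.Empty using (⊥-elim)
open import Data.Unit using (tt)
open import Function using (_∘_)
open import Level using (0ℓ)
open import Relation.Nullary using (¬_; yes; no; does; proof; Reflects; ofⁿ; invert; _→-reflects_)
open import Relation.Binary.PropositionalEquality using (_≡_; refl; subst)
open import Axiom.ExcludedMiddle using (ExcludedMiddle)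
open import Axiom.DoubleNegationElimination using (em⇒dne)

-- Every axiom holds at every time point of every model and the rules preserve
-- this, so the theorem follows by induction on derivations. Excluded middle is
-- needed because ∨', ∧', □, ⊟ and Ys are encoded through negation, and to turn a
-- model at time n into a Boolean valuation under which tautologies are evaluated.
-- The induction axioms hold by induction on ℕ, upwards for □ and downwards
-- (towards time 0) for ⊟; the fixpoint axioms for 𝒰 and 𝒮 split on whether the
-- witness is the current time point.

upward-induction : ∀ {ℓ} (P : ℕ → Set ℓ) {n : ℕ} →
                   (∀ {m} → n ≤ m → P m → P (suc m)) → P n → ∀ {m} → n ≤ m → P m
upward-induction P {n} preserved Pn = go ∘ ≤⇒≤′
  where
  go : ∀ {m} → n ≤′ m → P m
  go ≤′-refl         = Pn
  go (≤′-step n≤′m) = preserved (≤′⇒≤ n≤′m) (go n≤′m)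

downward-induction : ∀ {ℓ} (P : ℕ → Set ℓ) {n : ℕ} →
                     (∀ {m} → suc m ≤ n → P (suc m) → P m) → P n → ∀ {m} → m ≤ n → P m
downward-induction P preserved Pn = go preserved Pn ∘ ≤⇒≤′
  where
  go : ∀ {n} → (∀ {m} → suc m ≤ n → P (suc m) → P m) → P n → ∀ {m} → m ≤′ n → P m
  go preserved Pn ≤′-refl         = Pn
  go preserved Pn (≤′-step m≤′n) = go (preserved ∘ m≤n⇒m≤1+n) (preserved ≤-refl Pn) m≤′n

module Soundness (em : ExcludedMiddle 0ℓ) {h : ℕ} {CS : ConstSpec {h}} (M : Model CS) where

  -- Formulas are passed explicitly below: _⊨_ computes on them, so unification
  -- cannot recover them from satisfaction types.
  infix 4 _⊨_

  _⊨_ : ℕ → Fml h → Set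
  n ⊨ φ = M , n ⊨ φ

  private
    variable
      n : ℕ

  dne : {P : Set} → ¬ ¬ P → P
  dne = em⇒dne em

  ∧'-intro : ∀ φ ψ → n ⊨ φ → n ⊨ ψ → n ⊨ φ ∧' ψ
  ∧'-intro _ _ φn ψn f = f φn ψn

  ∧'-elim : ∀ φ ψ → n ⊨ φ ∧' ψ → n ⊨ φ × n ⊨ ψ
  ∧'-elim _ _ c = dne (λ ¬φ → c (λ φn _ → ¬φ φn)) , dne (λ ¬ψ → c (λ _ ψn → ¬ψ ψn))

  ∨'-intro : ∀ φ ψ → n ⊨ φ ⊎ n ⊨ ψ → n ⊨ φ ∨' ψ
  ∨'-intro _ _ (inj₁ φn) ¬φ = ⊥-elim (¬φ φn)
  ∨'-intro _ _ (inj₂ ψn) _  = ψn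

  ∨'-elim : ∀ φ ψ → n ⊨ φ ∨' ψ → n ⊨ φ ⊎ n ⊨ ψ
  ∨'-elim {n} φ _ d with em {n ⊨ φ}
  ... | yes φn = inj₁ φn
  ... | no ¬φ  = inj₂ (d ¬φ)

  □-intro : ∀ φ → (∀ {m} → n ≤ m → m ⊨ φ) → n ⊨ □ φ
  □-intro _ always (_ , n≤m , ¬φ , _) = ¬φ (always n≤m)

  □-elim : ∀ φ → n ⊨ □ φ → ∀ {m} → n ≤ m → m ⊨ φ
  □-elim _ □φ n≤m = dne λ ¬φ → □φ (_ , n≤m , ¬φ , λ _ _ _ ())

  ⊟-intro : ∀ φ → (∀ {m} → m ≤ n → m ⊨ φ) → n ⊨ ⊟ φ
  ⊟-intro _ always (_ , m≤n , ¬φ , _) = ¬φ (always m≤n)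

  ⊟-elim : ∀ φ → n ⊨ ⊟ φ → ∀ {m} → m ≤ n → m ⊨ φ
  ⊟-elim _ ⊟φ m≤n = dne λ ¬φ → ⊟φ (_ , m≤n , ¬φ , λ _ _ _ ())

  Ys-intro : ∀ φ → n ⊨ φ → suc n ⊨ Ys φ
  Ys-intro _ φn ¬φ = ¬φ φn

  Ys-elim : ∀ n φ → n ⊨ Ys φ → ∃[ k ] (n ≡ suc k × k ⊨ φ)
  Ys-elim zero    _ ys = ⊥-elim (ys tt)
  Ys-elim (suc k) _ ys = k , refl , dne ys

  □-K : ∀ φ ψ → n ⊨ □ (φ ⇒ ψ) → n ⊨ □ φ → n ⊨ □ ψ
  □-K φ ψ □φ⇒ψ □φ = □-intro ψ λ n≤m → □-elim (φ ⇒ ψ) □φ⇒ψ n≤m (□-elim φ □φ n≤m)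

  ⊟-K : ∀ φ ψ → n ⊨ ⊟ (φ ⇒ ψ) → n ⊨ ⊟ φ → n ⊨ ⊟ ψ
  ⊟-K φ ψ ⊟φ⇒ψ ⊟φ = ⊟-intro ψ λ m≤n → ⊟-elim (φ ⇒ ψ) ⊟φ⇒ψ m≤n (⊟-elim φ ⊟φ m≤n)

  □-induction : ∀ φ → n ⊨ □ (φ ⇒ ◯ φ) → n ⊨ φ → n ⊨ □ φ
  □-induction φ inv φn = □-intro φ (upward-induction (_⊨ φ) (□-elim (φ ⇒ ◯ φ) inv) φn)

  ⊟-induction : ∀ φ → n ⊨ ⊟ (φ ⇒ Yw φ) → n ⊨ φ → n ⊨ ⊟ φ
  ⊟-induction φ inv φn = ⊟-intro φ (downward-induction (_⊨ φ) (⊟-elim (φ ⇒ Yw φ) inv) φn)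

  𝒰-unfold : ∀ φ ψ → n ⊨ φ 𝒰 ψ → n ⊨ ψ ⊎ (n ⊨ φ × suc n ⊨ φ 𝒰 ψ)
  𝒰-unfold _ _ (m , n≤m , ψm , φ-before) with m≤n⇒m<n∨m≡n n≤m
  ... | inj₂ refl = inj₁ ψm
  ... | inj₁ n<m  = inj₂ (φ-before _ ≤-refl n<m , m , n<m , ψm , λ k n<k → φ-before k (<⇒≤ n<k))

  𝒰-fold : ∀ φ ψ → n ⊨ ψ ⊎ (n ⊨ φ × suc n ⊨ φ 𝒰 ψ) → n ⊨ φ 𝒰 ψ
  𝒰-fold {n} _ _ (inj₁ ψn) = n , ≤-refl , ψn , λ k n≤k k<n → ⊥-elim (≤⇒≯ n≤k k<n)
  𝒰-fold {n} φ _ (inj₂ (φn , m , n<m , ψm , φ-before)) = m , <⇒≤ n<m , ψm , φ-from-n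
    where
    φ-from-n : ∀ k → n ≤ k → k < m → k ⊨ φ
    φ-from-n k n≤k k<m with m≤n⇒m<n∨m≡n n≤k
    ... | inj₁ n<k  = φ-before k n<k k<m
    ... | inj₂ refl = φn

  𝒮-unfold : ∀ φ ψ → n ⊨ φ 𝒮 ψ → n ⊨ ψ ⊎ (n ⊨ φ × n ⊨ Ys (φ 𝒮 ψ))
  𝒮-unfold φ ψ (m , m≤n , ψm , φ-after) with m≤n⇒m<n∨m≡n m≤n
  ... | inj₂ refl = inj₁ ψm
  ... | inj₁ (s≤s m≤k) =
    inj₂ (φ-after _ (s≤s m≤k) ≤-refl ,
          Ys-intro (φ 𝒮 ψ) (m , m≤k , ψm , λ j m<j j≤k → φ-after j m<j (m≤n⇒m≤1+n j≤k)))

  𝒮-fold : ∀ φ ψ → n ⊨ ψ ⊎ (n ⊨ φ × n ⊨ Ys (φ 𝒮 ψ)) → n ⊨ φ 𝒮 ψ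
  𝒮-fold {n} _ _ (inj₁ ψn) = n , ≤-refl , ψn , λ k n<k k≤n → ⊥-elim (<⇒≱ n<k k≤n)
  𝒮-fold {n} φ ψ (inj₂ (φn , ys)) with Ys-elim n (φ 𝒮 ψ) ys
  ... | k , refl , (m , m≤k , ψm , φ-after) = m , m≤n⇒m≤1+n m≤k , ψm , φ-up-to-suc-k
    where
    φ-up-to-suc-k : ∀ j → m < j → j ≤ suc k → j ⊨ φ
    φ-up-to-suc-k j m<j j≤1+k with m≤n⇒m<n∨m≡n j≤1+k
    ... | inj₁ (s≤s j≤k) = φ-after j m<j j≤k
    ... | inj₂ refl      = φn

  ∨'∧'-intro : ∀ ψ φ χ → n ⊨ ψ ⊎ (n ⊨ φ × n ⊨ χ) → n ⊨ ψ ∨' (φ ∧' χ)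
  ∨'∧'-intro ψ φ χ = ∨'-intro ψ (φ ∧' χ) ∘ map₂ (uncurry (∧'-intro φ χ))

  ∨'∧'-elim : ∀ ψ φ χ → n ⊨ ψ ∨' (φ ∧' χ) → n ⊨ ψ ⊎ (n ⊨ φ × n ⊨ χ)
  ∨'∧'-elim ψ φ χ = map₂ (∧'-elim φ χ) ∘ ∨'-elim ψ (φ ∧' χ)

  𝒰-expansion : ∀ φ ψ → n ⊨ (φ 𝒰 ψ) ⇔ (ψ ∨' (φ ∧' ◯ (φ 𝒰 ψ)))
  𝒰-expansion φ ψ = ∧'-intro (φ 𝒰 ψ ⇒ expanded) (expanded ⇒ φ 𝒰 ψ)
    (∨'∧'-intro ψ φ (◯ (φ 𝒰 ψ)) ∘ 𝒰-unfold φ ψ)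
    (𝒰-fold φ ψ ∘ ∨'∧'-elim ψ φ (◯ (φ 𝒰 ψ)))
    where expanded = ψ ∨' (φ ∧' ◯ (φ 𝒰 ψ))

  𝒮-expansion : ∀ φ ψ → n ⊨ (φ 𝒮 ψ) ⇔ (ψ ∨' (φ ∧' Ys (φ 𝒮 ψ)))
  𝒮-expansion φ ψ = ∧'-intro (φ 𝒮 ψ ⇒ expanded) (expanded ⇒ φ 𝒮 ψ)
    (∨'∧'-intro ψ φ (Ys (φ 𝒮 ψ)) ∘ 𝒮-unfold φ ψ)
    (𝒮-fold φ ψ ∘ ∨'∧'-elim ψ φ (Ys (φ 𝒮 ψ)))
    where expanded = ψ ∨' (φ ∧' Ys (φ 𝒮 ψ))

  truth : ℕ → Fml h → Bool
  truth n χ = does (em {n ⊨ χ})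

  evalPL-truth-reflects : ∀ n φ → Reflects (n ⊨ φ) (evalPL (truth n) φ)
  evalPL-truth-reflects n falsum        = ofⁿ λ ()
  evalPL-truth-reflects n (φ ⇒ ψ)       = evalPL-truth-reflects n φ →-reflects evalPL-truth-reflects n ψ
  evalPL-truth-reflects n (atom p)      = proof em
  evalPL-truth-reflects n (◯ φ)         = proof em
  evalPL-truth-reflects n (Yw φ)        = proof em
  evalPL-truth-reflects n (φ 𝒰 ψ)       = proof em
  evalPL-truth-reflects n (φ 𝒮 ψ)       = proof em
  evalPL-truth-reflects n (⟦ t ⟧ i ∶ φ) = proof em

  tautology-sound : ∀ φ → Tautology φ → ∀ n → n ⊨ φ
  tautology-sound φ tautological n =
    invert (subst (Reflects (n ⊨ φ)) (tautological (truth n)) (evalPL-truth-reflects n φ))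

  axiom-sound : ∀ {φ} → Axiom φ → ∀ n → n ⊨ φ
  axiom-sound (taut {φ} t)     n       = tautology-sound φ t n
  axiom-sound (nextK _ _)      _       = λ f a → f a
  axiom-sound (boxK φ ψ)       _       = □-K φ ψ
  axiom-sound (nextFun _)      _       = λ f → f (λ x → x) (λ x → x)
  axiom-sound (ind φ)          _       = □-induction φ
  axiom-sound (untilD _ _)     _       = λ (m , n≤m , ψm , _) → m , n≤m , ψm , λ _ _ _ ()
  axiom-sound (untilF φ ψ)     _       = 𝒰-expansion φ ψ
  axiom-sound (pboxK φ ψ)      _       = ⊟-K φ ψ
  axiom-sound (ywK _ _)        zero    = λ _ _ → tt
  axiom-sound (ywK _ _)        (suc _) = λ f a → f a
  axiom-sound (ysyw _)         zero    = λ _ → tt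
  axiom-sound (ysyw _)         (suc _) = dne
  axiom-sound (nextYs φ)       _       = Ys-intro φ
  axiom-sound (ywNext _)       zero    = λ _ → tt
  axiom-sound (ywNext _)       (suc _) = λ φn → φn
  axiom-sound start            _       = zero , z≤n , tt , λ _ _ _ ()
  axiom-sound (pind φ)         _       = ⊟-induction φ
  axiom-sound (sinceD _ _)     _       = λ (m , m≤n , ψm , _) → m , m≤n , ψm , λ _ _ _ ()
  axiom-sound (sinceF φ ψ)     _       = 𝒮-expansion φ ψ
  axiom-sound (jApp i s t φ ψ) n       = λ (e₁ , φ⇒ψ) (e₂ , φn) → E-app M i (r M n) s t φ ψ e₁ e₂ , φ⇒ψ φn
  axiom-sound (jSumL i s t φ)  n       = λ (e , φn) → E-sumL M i (r M n) t s φ e , φn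
  axiom-sound (jSumR i s t φ)  n       = λ (e , φn) → E-sumR M i (r M n) t s φ e , φn
  axiom-sound (jRefl _ _ _)    _       = λ (_ , φn) → φn
  axiom-sound (jIntro i t φ)   n       = λ (e , φn) → E-bang M i (r M n) t φ e , e , φn

  constSpec-sound : ∀ {ψ} → CSShape ψ → _∈CS CS ψ → ∀ n → n ⊨ ψ
  constSpec-sound (base c i {φ} axiom) ψ∈CS n = E-cs M i (r M n) (con c) φ ψ∈CS , axiom-sound axiom n
  constSpec-sound (step c i {ψ} shape) ψ∈CS n =
    E-cs M i (r M n) (con c) ψ ψ∈CS , constSpec-sound shape (downward CS c i ψ ψ∈CS shape) n

  ⊢-sound : ∀ {φ} → ⊢[ CS ] φ → ∀ n → n ⊨ φ
  ⊢-sound (ax axiom)     n       = axiom-sound axiom n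
  ⊢-sound (mp ⊢φ⇒ψ ⊢φ)   n       = ⊢-sound ⊢φ⇒ψ n (⊢-sound ⊢φ n)
  ⊢-sound (necN ⊢φ)      n       = ⊢-sound ⊢φ (suc n)
  ⊢-sound (necY ⊢φ)      zero    = tt
  ⊢-sound (necY ⊢φ)      (suc n) = ⊢-sound ⊢φ n
  ⊢-sound (necB {φ} ⊢φ)  n       = □-intro φ λ {m} _ → ⊢-sound ⊢φ m
  ⊢-sound (necP {φ} ⊢φ)  n       = ⊟-intro φ λ {m} _ → ⊢-sound ⊢φ m
  ⊢-sound (csAx ψ∈CS)    n       = constSpec-sound (shape CS ψ∈CS) ψ∈CS n

  ⋀-sound : ∀ {Γ Δ} → All (n ⊨_) Γ → All (_∈ Γ) Δ → n ⊨ ⋀ Δ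
  ⋀-sound                 ⊨Γ []            = λ ()
  ⋀-sound {Δ = ψ ∷ Δ}     ⊨Γ (ψ∈Γ ∷ Δ⊆Γ) = ∧'-intro ψ (⋀ Δ) (lookup ⊨Γ ψ∈Γ) (⋀-sound ⊨Γ Δ⊆Γ)

theorem4 : ExcludedMiddle 0ℓ → (h : ℕ) → 1 ≤ h → (CS : ConstSpec {h}) → (Γ : List (Fml h)) → (φ : Fml h) → Γ ⊢[ CS ] φ → Γ ⊩[ CS ] φ
theorem4 em _ _ _ _ _ (_ , Δ⊆Γ , ⊢⋀Δ⇒φ) M n ⊨Γ = ⊢-sound ⊢⋀Δ⇒φ n (⋀-sound ⊨Γ Δ⊆Γ)
  where open Soundness em M
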